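{- Let $\mathfrak{X}=(\Gamma,c)$ be a configuration with exactly one empty colour, let $\Gamma_{\mathfrak{X}}$ be the graph on $\Gamma$ whose edges are the pairs $(v_1,v_2)$ with $c(v_1,v_2)$ a nonempty edge colour, and let $d$ denote (directed) distance in $\Gamma_{\mathfrak{X}}$. Let $\varphi\in\mathrm{Aut}(\mathfrak{X})$, $\varphi\neq\mathrm{Id}$, be such that every nontrivial element of $\langle\varphi\rangle$ has no fixed points. Then for any $v,w\in\Gamma$ and any integer $k\geq0$ such that $d(v,\varphi^i(w))>2^k$ for all $i$, the colour $c^{(k)}(v,\varphi^i(w))$ after $k$ iterations of the Weisfeiler-Leman algorithm is the same for all $i$.
   Context: A (classical) configuration is a pair $(\Gamma,c)$, $\Gamma$ finite, $c:\Gamma^2\to\mathcal{C}$ into a finite colour set, such that: (i) if $c(v,v)=c_0$ for some $v$ then $c(v_1,v_2)=c_0$ implies $v_1=v_2$; (ii) for each $c_0$ there is $c_0^{ -1}$ with $c(v_1,v_2)=c_0\Rightarrow c(v_2,v_1)=c_0^{ -1}$. Colours $c(v,v)$ are vertex colours, the others edge colours. An edge colour $c_0$ is nonempty if for every $v$ there is at most one $w$ with $c(v,w)=c_0$, and empty otherwise. An automorphism of $\mathfrak{X}$ is a bijection $\sigma$ of $\Gamma$ preserving $c$. The distance $d(x,y)$ is the length of a shortest directed path from $x$ to $y$ in $\Gamma_{\mathfrak{X}}$ ($\infty$ if none). Weisfeiler-Leman algorithm: $c^{(0)}=c$, $\mathcal{C}^{(0)}=\mathcal{C}$, and $c^{(h+1)}(v_1,v_2)$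 is the tuple consisting of $c^{(h)}(v_1,v_2)$ together with the numbers $\left|\{w: c^{(h)}(v_1,w)=c_1,\ c^{(h)}(w,v_2)=c_2\}\right|$ for all $(c_1,c_2)\in\mathcal{C}^{(h)}\times\mathcal{C}^{(h)}$. -}

module Defs where

open import Data.Nat using (ℕ; zero; suc; _+_; _≤_; _>_; _^_)
open import Data.Nat.Properties using () renaming (_≟_ to _≟ℕ_)
open import Data.Integer using (ℤ; +_; -[1+_])
open import Data.Fin using (Fin)
open import Data.Fin.Properties using () renaming (_≟_ to _≟F_)
open import Data.Fin.Permutation using (Permutation′; _⟨$⟩ʳ_; _⟨$⟩ˡ_)
open import Data.Product using (Σ; _×_; _,_; ∃)
import Data.Product.Properties as ×P
open import Data.Vec using (Vec; tabulate)
import Data.Vec.Properties as VecP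
open import Data.List using (List; map)
open import Data.Nat.ListAction using (sum)
open import Data.List.Base using (allFin)
open import Relation.Nullary using (¬_; Dec; yes; no)
open import Relation.Binary.Definitions using (DecidableEquality)
open import Relation.Binary.PropositionalEquality using (_≡_; _≢_)

Colouring : ℕ → ℕ → Set
Colouring n m = Fin n → Fin n → Fin m

record IsConfiguration {n m : ℕ} (c : Colouring n m) : Set where
  field
    vertexColours : ∀ (v v₁ v₂ : Fin n) → c v₁ v₂ ≡ c v v → v₁ ≡ v₂
    inverseColour : ∀ (c₀ : Fin m) → Σ (Fin m) λ c₀⁻¹ →
                      ∀ (v₁ v₂ : Fin n) → c v₁ v₂ ≡ c₀ → c v₂ v₁ ≡ c₀⁻¹

module _ {n m : ℕ} (c : Colouring n m) where

  IsVertexColour : Fin m → Set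
  IsVertexColour c₀ = ∃ λ (v : Fin n) → c v v ≡ c₀

  IsEdgeColour : Fin m → Set
  IsEdgeColour c₀ = ¬ IsVertexColour c₀

  AtMostOneOut : Fin m → Set
  AtMostOneOut c₀ = ∀ (v w w′ : Fin n) → c v w ≡ c₀ → c v w′ ≡ c₀ → w ≡ w′

  NonemptyEdgeColour : Fin m → Set
  NonemptyEdgeColour c₀ = IsEdgeColour c₀ × AtMostOneOut c₀

  EmptyColour : Fin m → Set
  EmptyColour c₀ = IsEdgeColour c₀ × ¬ AtMostOneOut c₀

  ExactlyOneEmptyColour : Set
  ExactlyOneEmptyColour =
    Σ (Fin m) λ e → EmptyColour e × (∀ (e′ : Fin m) → EmptyColour e′ → e′ ≡ e)

  Edge : Fin n → Fin n → Set
  Edge v₁ v₂ = NonemptyEdgeColour (c v₁ v₂)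

  data Walk : ℕ → Fin n → Fin n → Set where
    [] : ∀ {x} → Walk zero x x
    _∷_ : ∀ {ℓ x y z} → Edge x y → Walk ℓ y z → Walk (suc ℓ) x z

  -- d(x,y) > N : no directed walk (equivalently, path) of length ≤ N from x to y
  -- (this includes the case d(x,y) = ∞)
  DistGreaterThan : Fin n → Fin n → ℕ → Set
  DistGreaterThan x y N = ∀ (ℓ : ℕ) → ℓ ≤ N → ¬ Walk ℓ x y

  IsAutomorphism : Permutation′ n → Set
  IsAutomorphism σ = ∀ (v₁ v₂ : Fin n) → c (σ ⟨$⟩ʳ v₁) (σ ⟨$⟩ʳ v₂) ≡ c v₁ v₂

iter : {A : Set} → (A → A) → ℕ → A → A
iter f zero x = x
iter f (suc k) x = f (iter f k x)

pow : {n : ℕ} → Permutation′ n → ℤ → Fin n → Fin n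
pow φ (+ k) = iter (φ ⟨$⟩ʳ_) k
pow φ -[1+ k ] = iter (φ ⟨$⟩ˡ_) (suc k)

IsIdentity : {n : ℕ} → (Fin n → Fin n) → Set
IsIdentity {n} f = ∀ (v : Fin n) → f v ≡ v

-- The colour set 𝒞⁽ʰ⁾ is enumerated by the colours actually realised,
-- c⁽ʰ⁾(a,b) for (a,b) ∈ Γ²; so the count vector is indexed by
-- (a,b,a′,b′) ∈ Γ⁴, the entry being
--   |{ w : c⁽ʰ⁾(v₁,w) = c⁽ʰ⁾(a,b), c⁽ʰ⁾(w,v₂) = c⁽ʰ⁾(a′,b′) }|.
-- (Counts for unrealised colour pairs are always 0, so nothing is lost.)

CountVec : ℕ → Set
CountVec n = Vec (Vec (Vec (Vec ℕ n) n) n) n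

Col : ℕ → ℕ → ℕ → Set
Col n m zero = Fin m
Col n m (suc h) = Col n m h × CountVec n

countVec-dec : (n : ℕ) → DecidableEquality (CountVec n)
countVec-dec n = VecP.≡-dec (VecP.≡-dec (VecP.≡-dec (VecP.≡-dec _≟ℕ_)))

col-dec : (n m h : ℕ) → DecidableEquality (Col n m h)
col-dec n m zero = _≟F_
col-dec n m (suc h) = ×P.≡-dec (col-dec n m h) (countVec-dec n)

count : {n : ℕ} {P : Fin n → Set} → (∀ w → Dec (P w)) → ℕ
count {n} P? = sum (map (λ w → indicator (P? w)) (allFin n))
  where
  indicator : ∀ {A : Set} → Dec A → ℕ
  indicator (yes _) = 1
  indicator (no _) = 0

WL : {n m : ℕ} → Colouring n m → (h : ℕ) → Fin n → Fin n → Col n m h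
WL c zero v₁ v₂ = c v₁ v₂
WL {n} {m} c (suc h) v₁ v₂ =
  WL c h v₁ v₂ ,
  tabulate λ a → tabulate λ b → tabulate λ a′ → tabulate λ b′ →
    count (λ w → ×-dec′ (col-dec n m h (WL c h v₁ w) (WL c h a b))
                        (col-dec n m h (WL c h w v₂) (WL c h a′ b′)))
  where
  ×-dec′ : ∀ {A B : Set} → Dec A → Dec B → Dec (A × B)
  ×-dec′ (yes a) (yes b) = yes (a , b)
  ×-dec′ (no ¬a) _ = no λ { (a , _) → ¬a a }
  ×-dec′ (yes _) (no ¬b) = no λ { (_ , b) → ¬b b }

-- Induction on k, for any group of automorphisms acting on Γ. For k = 0 both
-- colours are the unique empty colour. For the step let N = 2^k and call u
-- near if some image of u under the group lies within distance N of v. The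
-- bijection fixing near vertices and moving the others by φⁱ matches the
-- vertices counted for (v, w) with those counted for (v, φⁱ w): a near u has
-- orbit distance > N to w (else v would be within 2N of the orbit of w), so
-- c⁽ᵏ⁾(u, w) is orbit-invariant by induction; for a far u the induction
-- hypothesis applies to (v, u), and c⁽ᵏ⁾(u, w) = c⁽ᵏ⁾(φⁱ u, φⁱ w) since φⁱ is
-- an automorphism. Nearness is not decidable, but the conclusion is a
-- decidable equation, so a double-negated decision procedure suffices.
module Submission where

open import Defs
open import Data.Nat using (ℕ; _^_; zero; suc; _+_; _≤_; z≤n; s≤s)
open import Data.Nat.Properties
  using (+-identityʳ; +-comm; +-mono-≤; ≤-trans; m≤m+n; +-0-commutativeMonoid)
open import Data.Nat.ListAction using (sum)
open import Data.Integer using (ℤ; -[1+_])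
import Data.Integer as ℤ
open import Data.Fin using (Fin; zero; suc)
open import Data.Fin.Permutation
  using (Permutation′; _⟨$⟩ʳ_; _⟨$⟩ˡ_; permutation; inverseʳ; inverseˡ)
open import Data.List using (map; tabulate)
open import Data.List.Base using (allFin)
open import Data.List.Properties using (map-tabulate)
open import Data.Product using (Σ; ∃; _×_; _,_; swap)
open import Data.Vec.Properties using (tabulate-cong)
open import Function using (_∘_)
open import Relation.Nullary using (¬_; Dec; yes; no; contradiction)
open import Relation.Nullary.Decidable using (decidable-stable; ¬¬-excluded-middle)
open import Relation.Binary.PropositionalEquality
  using (_≡_; _≗_; refl; sym; trans; cong; cong₂; subst; module ≡-Reasoning)
import Algebra.Properties.CommutativeMonoid.Sum as Sum

module Σᶠ = Sum +-0-commutativeMonoid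

-- The indicator hidden in `count` is recovered as a count over a one-element
-- set, so it agrees with the original only up to `+ 0`.
indicator : {A : Set} → Dec A → ℕ
indicator a = count {1} (λ _ → a)

indicator-cong : {A B : Set} (a : Dec A) (b : Dec B) →
                 (A → B) → (B → A) → indicator a ≡ indicator b
indicator-cong (yes _) (yes _) _ _ = refl
indicator-cong (no _)  (no _)  _ _ = refl
indicator-cong (yes x) (no ¬y) f _ = contradiction (f x) ¬y
indicator-cong (no ¬x) (yes y) _ g = contradiction (g y) ¬x

sum-tabulate : ∀ {n} (f : Fin n → ℕ) → sum (tabulate f) ≡ Σᶠ.sum f
sum-tabulate {zero}  f = refl
sum-tabulate {suc n} f = cong (f zero +_) (sum-tabulate (f ∘ suc))

count≡sum : ∀ {n} {P : Fin n → Set} (P? : ∀ w → Dec (P w)) →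
            count P? ≡ Σᶠ.sum (indicator ∘ P?)
count≡sum {n} P? =
  trans (cong sum (map-tabulate {n = n} (λ w → w) _))
  (trans (sum-tabulate {n} _)
         (Σᶠ.sum-cong-≗ {n} λ _ → sym (+-identityʳ _)))

count-permute : ∀ {n} {P Q : Fin n → Set} (P? : ∀ w → Dec (P w)) (Q? : ∀ w → Dec (Q w))
                (π : Permutation′ n) →
                (∀ u → P u → Q (π ⟨$⟩ʳ u)) → (∀ u → Q (π ⟨$⟩ʳ u) → P u) →
                count P? ≡ count Q?
count-permute P? Q? π to from = begin
  count P?                               ≡⟨ count≡sum P? ⟩
  Σᶠ.sum (indicator ∘ P?)                ≡⟨ Σᶠ.sum-cong-≗ (λ u →
                                              indicator-cong (P? u) (Q? (π ⟨$⟩ʳ u)) (to u) (from u)) ⟩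
  Σᶠ.sum (indicator ∘ Q? ∘ (π ⟨$⟩ʳ_))    ≡⟨ Σᶠ.sum-permute (indicator ∘ Q?) π ⟨
  Σᶠ.sum (indicator ∘ Q?)                ≡⟨ count≡sum Q? ⟨
  count Q?                               ∎
  where open ≡-Reasoning

¬¬-decidable : ∀ {n} (P : Fin n → Set) → ¬ ¬ (∀ u → Dec (P u))
¬¬-decidable {zero}  P k = k λ ()
¬¬-decidable {suc n} P k =
  ¬¬-excluded-middle λ P₀? → ¬¬-decidable (P ∘ suc) λ P₊? →
    k λ { zero → P₀? ; (suc u) → P₊? u }

module _ {A : Set} {S : A → Set} (S? : ∀ u → Dec (S u)) where

  moveOutside : (A → A) → A → A
  moveOutside f u with S? u
  ... | yes _ = u
  ... | no  _ = f u

  moveOutside-inside : ∀ f {u} → S u → moveOutside f u ≡ u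
  moveOutside-inside f {u} s with S? u
  ... | yes _ = refl
  ... | no ¬s = contradiction s ¬s

  moveOutside-outside : ∀ f {u} → ¬ S u → moveOutside f u ≡ f u
  moveOutside-outside f {u} ¬s with S? u
  ... | yes s = contradiction s ¬s
  ... | no  _ = refl

  moveOutside-inverse : ∀ f g → (∀ u → g (f u) ≡ u) → (∀ u → S (f u) → S u) →
                        ∀ u → moveOutside g (moveOutside f u) ≡ u
  moveOutside-inverse f g gf S-back u = byCases (S? u)
    where
    open ≡-Reasoning
    byCases : Dec (S u) → moveOutside g (moveOutside f u) ≡ u
    byCases (yes s) =
      trans (cong (moveOutside g) (moveOutside-inside f s)) (moveOutside-inside g s)
    byCases (no ¬s) = begin
      moveOutside g (moveOutside f u) ≡⟨ cong (moveOutside g) (moveOutside-outside f ¬s) ⟩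
      moveOutside g (f u)             ≡⟨ moveOutside-outside g (¬s ∘ S-back u) ⟩
      g (f u)                         ≡⟨ gf u ⟩
      u                               ∎

module _ {n m : ℕ} {c : Colouring n m} where

  _++ʷ_ : ∀ {a b x y z} → Walk c a x y → Walk c b y z → Walk c (a + b) x z
  []      ++ʷ W = W
  (e ∷ V) ++ʷ W = e ∷ (V ++ʷ W)

  Walk-map : ∀ (f : Fin n → Fin n) → (∀ a b → c (f a) (f b) ≡ c a b) →
             ∀ {ℓ x y} → Walk c ℓ x y → Walk c ℓ (f x) (f y)
  Walk-map f f-pres []                      = []
  Walk-map f f-pres (_∷_ {x = x} {y} e W) =
    subst (NonemptyEdgeColour c) (sym (f-pres x y)) e ∷ Walk-map f f-pres W

module _ {n m : ℕ} (c : Colouring n m) where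

  WL-suc-cong : ∀ h {v₁ v₂ v₁′ v₂′} (π : Permutation′ n) →
                WL c h v₁ v₂ ≡ WL c h v₁′ v₂′ →
                (∀ u → WL c h v₁ u ≡ WL c h v₁′ (π ⟨$⟩ʳ u) ×
                       WL c h u v₂ ≡ WL c h (π ⟨$⟩ʳ u) v₂′) →
                WL c (suc h) v₁ v₂ ≡ WL c (suc h) v₁′ v₂′
  WL-suc-cong h π same matched = cong₂ _,_ same
    (tabulate-cong λ _ → tabulate-cong λ _ → tabulate-cong λ _ → tabulate-cong λ _ →
      count-permute _ _ π
        (λ u (e₁ , e₂) → let (m₁ , m₂) = matched u in trans (sym m₁) e₁ , trans (sym m₂) e₂)
        (λ u (e₁ , e₂) → let (m₁ , m₂) = matched u in trans m₁ e₁ , trans m₂ e₂))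

  WL-automorphism : ∀ (π : Permutation′ n) → IsAutomorphism c π →
                    ∀ h a b → WL c h (π ⟨$⟩ʳ a) (π ⟨$⟩ʳ b) ≡ WL c h a b
  WL-automorphism π π-aut zero    a b = π-aut a b
  WL-automorphism π π-aut (suc h) a b =
    sym (WL-suc-cong h π (sym (IH a b)) (λ u → sym (IH a u) , sym (IH u b)))
    where IH = WL-automorphism π π-aut h

module OrbitInvariance
  {n m : ℕ} (c : Colouring n m) (c-config : IsConfiguration c)
  (e : Fin m) (e-unique : ∀ e′ → EmptyColour c e′ → e′ ≡ e)
  {G : Set} (act : G → Fin n → Fin n) (_·_ : G → G → G) (_⁻¹ : G → G)
  (act-· : ∀ g g′ x → act g (act g′ x) ≡ act (g · g′) x)
  (act-⁻¹ˡ : ∀ g x → act (g ⁻¹) (act g x) ≡ x)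
  (act-⁻¹ʳ : ∀ g x → act g (act (g ⁻¹) x) ≡ x)
  (act-preserves : ∀ g a b → c (act g a) (act g b) ≡ c a b)
  where

  OrbitFar : ℕ → Fin n → Fin n → Set
  OrbitFar N v x = ∀ g → DistGreaterThan c v (act g x) N

  Near : ℕ → Fin n → Fin n → Set
  Near N v u = Σ G λ g → ∃ λ ℓ → ℓ ≤ N × Walk c ℓ v (act g u)

  OrbitFar-mono : ∀ {N N′ v x} → N ≤ N′ → OrbitFar N′ v x → OrbitFar N v x
  OrbitFar-mono N≤N′ far g ℓ ℓ≤N = far g ℓ (≤-trans ℓ≤N N≤N′)

  OrbitFar⇒DistGreaterThan : ∀ {N v x} → G → OrbitFar N v x → DistGreaterThan c v x N
  OrbitFar⇒DistGreaterThan {v = v} {x} g far ℓ ℓ≤N W =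
    far ((g ⁻¹) · g) ℓ ℓ≤N
      (subst (Walk c ℓ v) (trans (sym (act-⁻¹ˡ g x)) (act-· (g ⁻¹) g x)) W)

  ¬Near⇒OrbitFar : ∀ {N v u} → ¬ Near N v u → OrbitFar N v u
  ¬Near⇒OrbitFar ¬near g ℓ ℓ≤N W = ¬near (g , ℓ , ℓ≤N , W)

  Near-act : ∀ {N v} g {u} → Near N v (act g u) → Near N v u
  Near-act g {u} (g′ , ℓ , ℓ≤N , W) =
    g′ · g , ℓ , ℓ≤N , subst (Walk c ℓ _) (act-· g′ g u) W

  Near⇒OrbitFar : ∀ {N v u x} → Near N v u → OrbitFar (N + N) v x → OrbitFar N u x
  Near⇒OrbitFar {x = x} (g′ , ℓ′ , ℓ′≤N , V) far g ℓ ℓ≤N W =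
    far (g′ · g) (ℓ′ + ℓ) (+-mono-≤ ℓ′≤N ℓ≤N)
      (V ++ʷ subst (Walk c ℓ _) (act-· g′ g x) (Walk-map (act g′) (act-preserves g′) W))

  actPermutation : G → Permutation′ n
  actPermutation g = permutation (act g) (act (g ⁻¹)) (act-⁻¹ʳ g) (act-⁻¹ˡ g)

  DistGreaterThan1⇒empty : ∀ {v y} → DistGreaterThan c v y 1 → c v y ≡ e
  DistGreaterThan1⇒empty {v} {y} far = e-unique (c v y) (notVertex , notAtMostOne)
    where
    notVertex : IsEdgeColour c (c v y)
    notVertex (u , c-uu) =
      far 0 z≤n (subst (Walk c 0 v) (IsConfiguration.vertexColours c-config u v y (sym c-uu)) [])
    notAtMostOne : ¬ AtMostOneOut c (c v y)
    notAtMostOne atMostOne = far 1 (s≤s z≤n) ((notVertex , atMostOne) ∷ [])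

  WL-orbitInvariant : ∀ h v x → OrbitFar (2 ^ h) v x → ∀ g → WL c h v x ≡ WL c h v (act g x)
  WL-orbitInvariant zero v x far g =
    trans (DistGreaterThan1⇒empty (OrbitFar⇒DistGreaterThan g far))
          (sym (DistGreaterThan1⇒empty (far g)))
  WL-orbitInvariant (suc h) v x far g =
    decidable-stable (col-dec n m (suc h) _ _) λ ≢ →
      ¬¬-decidable (Near N v) λ near? → ≢ (countsMatch near?)
    where
    N = 2 ^ h
    far₂ : OrbitFar (N + N) v x
    far₂ = subst (λ M → OrbitFar M v x) (cong (N +_) (+-identityʳ N)) far
    IH = WL-orbitInvariant h

    countsMatch : (∀ u → Dec (Near N v u)) → WL c (suc h) v x ≡ WL c (suc h) v (act g x)
    countsMatch near? = WL-suc-cong c h π (IH v x (OrbitFar-mono (m≤m+n N N) far₂) g) matched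
      where
      σ = moveOutside near? (act g)
      σ⁻¹ = moveOutside near? (act (g ⁻¹))
      π : Permutation′ n
      π = permutation σ σ⁻¹
            (moveOutside-inverse near? (act (g ⁻¹)) (act g) (act-⁻¹ʳ g) (λ _ → Near-act (g ⁻¹)))
            (moveOutside-inverse near? (act g) (act (g ⁻¹)) (act-⁻¹ˡ g) (λ _ → Near-act g))
      matched : ∀ u → WL c h v u ≡ WL c h v (σ u) × WL c h u x ≡ WL c h (σ u) (act g x)
      matched u with near? u
      ... | yes near = refl , IH u x (Near⇒OrbitFar near far₂) g
      ... | no ¬near =
        IH v u (¬Near⇒OrbitFar ¬near) g ,
        sym (WL-automorphism c (actPermutation g) (act-preserves g) h u x)

iter-commute : ∀ {A : Set} (f g : A → A) → f ∘ g ≗ g ∘ f →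
               ∀ a x → iter f a (g x) ≡ g (iter f a x)
iter-commute f g fg zero    x = refl
iter-commute f g fg (suc a) x = trans (cong f (iter-commute f g fg a x)) (fg _)

iter-iter-commute : ∀ {A : Set} (f g : A → A) → f ∘ g ≗ g ∘ f →
                    ∀ a b x → iter f a (iter g b x) ≡ iter g b (iter f a x)
iter-iter-commute f g fg a zero    x = refl
iter-iter-commute f g fg a (suc b) x =
  trans (iter-commute f g fg a _) (cong g (iter-iter-commute f g fg a b x))

iter-+ : ∀ {A : Set} (f : A → A) a b x → iter f a (iter f b x) ≡ iter f (a + b) x
iter-+ f zero    b x = refl
iter-+ f (suc a) b x = cong f (iter-+ f a b x)

_+²_ : ℕ × ℕ → ℕ × ℕ → ℕ × ℕ
(p , q) +² (p′ , q′) = p + p′ , q + q′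

module _ {n : ℕ} (φ : Permutation′ n) where

  private
    φʳ φˡ : Fin n → Fin n
    φʳ = φ ⟨$⟩ʳ_
    φˡ = φ ⟨$⟩ˡ_

    φʳφˡ≗φˡφʳ : φʳ ∘ φˡ ≗ φˡ ∘ φʳ
    φʳφˡ≗φˡφʳ x = trans (inverseʳ φ) (sym (inverseˡ φ))

  -- φ^(p − q): integer powers of φ represented by pairs of naturals.
  powDiff : ℕ × ℕ → Fin n → Fin n
  powDiff (p , q) x = iter φʳ p (iter φˡ q x)

  powDiff-+² : ∀ g g′ x → powDiff g (powDiff g′ x) ≡ powDiff (g +² g′) x
  powDiff-+² (p , q) (p′ , q′) x = begin
    iter φʳ p (iter φˡ q (iter φʳ p′ (iter φˡ q′ x)))
      ≡⟨ cong (iter φʳ p) (iter-iter-commute φˡ φʳ (sym ∘ φʳφˡ≗φˡφʳ) q p′ _) ⟩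
    iter φʳ p (iter φʳ p′ (iter φˡ q (iter φˡ q′ x)))
      ≡⟨ iter-+ φʳ p p′ _ ⟩
    iter φʳ (p + p′) (iter φˡ q (iter φˡ q′ x))
      ≡⟨ cong (iter φʳ (p + p′)) (iter-+ φˡ q q′ x) ⟩
    iter φʳ (p + p′) (iter φˡ (q + q′) x)
      ∎
    where open ≡-Reasoning

  powDiff-suc-suc : ∀ p q x → powDiff (suc p , suc q) x ≡ powDiff (p , q) x
  powDiff-suc-suc p q x =
    trans (cong φʳ (iter-commute φʳ φˡ φʳφˡ≗φˡφʳ p _)) (inverseʳ φ)

  powDiff-diagonal : ∀ k x → powDiff (k , k) x ≡ x
  powDiff-diagonal zero    x = refl
  powDiff-diagonal (suc k) x = trans (powDiff-suc-suc k k x) (powDiff-diagonal k x)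

  powDiff-swap : ∀ g x → powDiff (swap g) (powDiff g x) ≡ x
  powDiff-swap (p , q) x = begin
    powDiff (q , p) (powDiff (p , q) x) ≡⟨ powDiff-+² (q , p) (p , q) x ⟩
    powDiff (q + p , p + q) x           ≡⟨ cong (λ k → powDiff (k , p + q) x) (+-comm q p) ⟩
    powDiff (p + q , p + q) x           ≡⟨ powDiff-diagonal (p + q) x ⟩
    x                                   ∎
    where open ≡-Reasoning

  pow≗powDiff : ∀ i → ∃ λ g → pow φ i ≗ powDiff g
  pow≗powDiff (ℤ.+ p)  = (p , 0)     , λ _ → refl
  pow≗powDiff -[1+ q ] = (0 , suc q) , λ _ → refl

  powDiff≗pow : ∀ g → ∃ λ i → powDiff g ≗ pow φ i
  powDiff≗pow (p     , zero)  = ℤ.+ p    , λ _ → refl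
  powDiff≗pow (zero  , suc q) = -[1+ q ] , λ _ → refl
  powDiff≗pow (suc p , suc q) =
    let (i , eq) = powDiff≗pow (p , q) in i , λ x → trans (powDiff-suc-suc p q x) (eq x)

  powDiff-preserves : ∀ {m} (c : Colouring n m) → IsAutomorphism c φ →
                      ∀ g a b → c (powDiff g a) (powDiff g b) ≡ c a b
  powDiff-preserves c φ-aut (p , q) a b =
    trans (iterPreserves φʳ φ-aut p _ _) (iterPreserves φˡ φˡ-aut q a b)
    where
    φˡ-aut : ∀ a b → c (φˡ a) (φˡ b) ≡ c a b
    φˡ-aut a b = trans (sym (φ-aut (φˡ a) (φˡ b))) (cong₂ c (inverseʳ φ) (inverseʳ φ))
    iterPreserves : ∀ f → (∀ a b → c (f a) (f b) ≡ c a b) →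
                    ∀ k a b → c (iter f k a) (iter f k b) ≡ c a b
    iterPreserves f f-pres zero    a b = refl
    iterPreserves f f-pres (suc k) a b = trans (f-pres _ _) (iterPreserves f f-pres k a b)

lemma3 : ∀ {n m : ℕ} (c : Colouring n m) → IsConfiguration c →
           ExactlyOneEmptyColour c →
           (φ : Permutation′ n) → IsAutomorphism c φ →
           ¬ IsIdentity (φ ⟨$⟩ʳ_) →
           (∀ (i : ℤ) → ¬ IsIdentity (pow φ i) → ∀ (v : Fin n) → ¬ (pow φ i v ≡ v)) →
           ∀ (v w : Fin n) (k : ℕ) →
           (∀ (i : ℤ) → DistGreaterThan c v (pow φ i w) (2 ^ k)) →
           ∀ (i j : ℤ) → WL c k v (pow φ i w) ≡ WL c k v (pow φ j w)
lemma3 c c-config (e , _ , e-unique) φ φ-aut _ _ v w k far i j =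
  trans (sym (atPow i)) (atPow j)
  where
  open OrbitInvariance c c-config e e-unique (powDiff φ) _+²_ swap (powDiff-+² φ)
         (powDiff-swap φ) (λ g → powDiff-swap φ (swap g)) (powDiff-preserves φ c φ-aut)

  orbitFar : OrbitFar (2 ^ k) v w
  orbitFar g = let (i , eq) = powDiff≗pow φ g in
    subst (λ y → DistGreaterThan c v y (2 ^ k)) (sym (eq w)) (far i)

  atPow : ∀ i → WL c k v w ≡ WL c k v (pow φ i w)
  atPow i = let (g , eq) = pow≗powDiff φ i in
    trans (WL-orbitInvariant k v w orbitFar g) (cong (WL c k v) (sym (eq w)))
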